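{- Let $F$ be an exponential field whose kernel $\operatorname{Ker}=\{x\in F : \mathrm{E}(x)=1\}$ is an infinite cyclic group. Then every real abelian algebraic number is pointwise definable in $F$: for every $\alpha\in\mathbb{Q}^{\mathrm{rab}}\subseteq F$ there is a first-order formula $\varphi(x)$ without parameters, in the language $\{+,\cdot,-,0,1,\mathrm{E}\}$, such that $\alpha$ is the unique element of $F$ satisfying $\varphi$.
   Context: An exponential field (E-field) is a field $F$ of characteristic $0$ together with a map $\mathrm{E}:F\to F$ satisfying $\mathrm{E}(0)=1$ and $\mathrm{E}(x+y)=\mathrm{E}(x)\mathrm{E}(y)$. If $\operatorname{Ker}$ is infinite cyclic with generator $\tau$, then the elements $\mathrm{E}(j\tau/n)$, $j=0,\dots,n-1$, are the distinct $n$-th roots of unity, so $F$ contains the group $U$ of all roots of unity and hence the maximal abelian extension $\mathbb{Q}^{\mathrm{ab}}=\mathbb{Q}(U)$ of $\mathbb{Q}$. Let $\sigma_0$ be the field automorphism of $\mathbb{Q}^{\mathrm{ab}}$ determined by $\sigma_0(x)=x^{ -1}$ for all $x\in U$. The field of real abelian numbers is $\mathbb{Q}^{\mathrm{rab}}=\{x\in\mathbb{Q}^{\mathrm{ab}}:\sigma_0(x)=x\}$. -}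

module Defs where

open import Level using (Level; _⊔_; Lift)
open import Data.Nat using (ℕ; zero; suc; NonZero)
open import Data.Integer using (ℤ; +_; -[1+_])
open import Data.Fin using (Fin; zero; suc)
open import Data.List using (List; []; _∷_)
open import Data.Product using (Σ; _×_; ∃; _,_)
open import Data.Sum using (_⊎_)
open import Data.Empty using (⊥)
open import Data.Unit.Polymorphic using (⊤)
open import Relation.Nullary using (¬_)
open import Algebra.Bundles using (CommutativeRing)

module Casts {c ℓ : Level} (R : CommutativeRing c ℓ) where
  open CommutativeRing R

  natCast : ℕ → Carrier
  natCast zero    = 0#
  natCast (suc n) = 1# + natCast n

  intCast : ℤ → Carrier
  intCast (+ n)     = natCast n
  intCast -[1+ n ]  = - natCast (suc n)

record ExpField (c ℓ : Level) : Set (Level.suc (c ⊔ ℓ)) where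
  field
    commRing : CommutativeRing c ℓ
  open CommutativeRing commRing public hiding (ring)
  open Casts commRing public
  field
    0≉1      : ¬ (0# ≈ 1#)
    inverse  : ∀ x → ¬ (x ≈ 0#) → Σ Carrier (λ y → x * y ≈ 1#)
    char0    : ∀ n → ¬ (natCast (suc n) ≈ 0#)
    E        : Carrier → Carrier
    E-cong   : ∀ {x y} → x ≈ y → E x ≈ E y
    E-0      : E 0# ≈ 1#
    E-+      : ∀ x y → E (x + y) ≈ E x * E y

module _ {c ℓ : Level} (F : ExpField c ℓ) where
  open ExpField F

  -- Ker = { x | E x = 1 } is infinite cyclic: generated by some τ ≠ 0
  -- (in characteristic 0, ⟨τ⟩ = ℤτ is infinite iff τ ≠ 0).
  IsKerGenerator : Carrier → Set (c ⊔ ℓ)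
  IsKerGenerator τ =
    (E τ ≈ 1#) × ¬ (τ ≈ 0#) ×
    (∀ x → E x ≈ 1# → Σ ℤ (λ k → x ≈ intCast k * τ))

  KerInfiniteCyclic : Set (c ⊔ ℓ)
  KerInfiniteCyclic = Σ Carrier IsKerGenerator

  -- evaluation of an integer polynomial (coefficient list, constant
  -- term first) at a point, by Horner's rule
  evalPoly : List ℤ → Carrier → Carrier
  evalPoly []       z = 0#
  evalPoly (a ∷ as) z = intCast a + z * evalPoly as z

  -- Q^ab ⊆ F: α = p(ζ)/d with ζ = E(τ/n) (n ≥ 1), p ∈ ℤ[X], d ≠ 0;
  -- here τ/n is the unique t with n·t = τ.
  -- α ∈ Q^rab: moreover σ₀(α) = α, where σ₀(p(ζ)/d) = p(ζ⁻¹)/d and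
  -- ζ⁻¹ = E(τ/n)⁻¹ = E(-(τ/n)).
  IsRealAbelian : Carrier → Carrier → Set (c ⊔ ℓ)
  IsRealAbelian τ α =
    Σ ℕ λ n → Σ Carrier λ t → Σ (List ℤ) λ p → Σ ℕ λ d →
      (natCast (suc n) * t ≈ τ) ×
      (natCast (suc d) * α ≈ evalPoly p (E t)) ×
      (natCast (suc d) * α ≈ evalPoly p (E (- t)))

data Term (n : ℕ) : Set where
  var  : Fin n → Term n
  zer  : Term n
  one  : Term n
  _⊕_  : Term n → Term n → Term n
  _⊗_  : Term n → Term n → Term n
  neg  : Term n → Term n
  exp  : Term n → Term n

data Formula : ℕ → Set where
  _≐_   : ∀ {n} → Term n → Term n → Formula n
  falsum : ∀ {n} → Formula n
  ~_    : ∀ {n} → Formula n → Formula n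
  _∧_   : ∀ {n} → Formula n → Formula n → Formula n
  _∨_   : ∀ {n} → Formula n → Formula n → Formula n
  _⇒_   : ∀ {n} → Formula n → Formula n → Formula n
  all   : ∀ {n} → Formula (suc n) → Formula n
  ex    : ∀ {n} → Formula (suc n) → Formula n

module _ {c ℓ : Level} (F : ExpField c ℓ) where
  open ExpField F

  extend : ∀ {n} → Carrier → (Fin n → Carrier) → Fin (suc n) → Carrier
  extend x ρ zero    = x
  extend x ρ (suc i) = ρ i

  ⟦_⟧t : ∀ {n} → Term n → (Fin n → Carrier) → Carrier
  ⟦ var i ⟧t ρ = ρ i
  ⟦ zer ⟧t   ρ = 0#
  ⟦ one ⟧t   ρ = 1#
  ⟦ s ⊕ t ⟧t ρ = ⟦ s ⟧t ρ + ⟦ t ⟧t ρ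
  ⟦ s ⊗ t ⟧t ρ = ⟦ s ⟧t ρ * ⟦ t ⟧t ρ
  ⟦ neg s ⟧t ρ = - ⟦ s ⟧t ρ
  ⟦ exp s ⟧t ρ = E (⟦ s ⟧t ρ)

  Sat : ∀ {n} → Formula n → (Fin n → Carrier) → Set (c ⊔ ℓ)
  Sat (s ≐ t)  ρ = Lift (c ⊔ ℓ) (⟦ s ⟧t ρ ≈ ⟦ t ⟧t ρ)
  Sat falsum   ρ = Lift (c ⊔ ℓ) ⊥
  Sat (~ φ)    ρ = ¬ Sat φ ρ
  Sat (φ ∧ ψ)  ρ = Sat φ ρ × Sat ψ ρ
  Sat (φ ∨ ψ)  ρ = Sat φ ρ ⊎ Sat ψ ρ
  Sat (φ ⇒ ψ)  ρ = Sat φ ρ → Sat ψ ρ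
  Sat (all φ)  ρ = ∀ x → Sat φ (extend x ρ)
  Sat (ex φ)   ρ = Σ Carrier (λ x → Sat φ (extend x ρ))

  Defines : Formula 1 → Carrier → Set (c ⊔ ℓ)
  Defines φ α = Sat φ (λ _ → α) × (∀ y → Sat φ (λ _ → y) → y ≈ α)

  PointwiseDefinable : Carrier → Set (c ⊔ ℓ)
  PointwiseDefinable α = Σ (Formula 1) (λ φ → Defines φ α)

{-# OPTIONS --safe #-}
module Submission where

-- The generator τ of Ker is first-order definable up to sign: the non-zero
-- x ∈ Ker with y²/x ∈ Ker for every y ∈ Ker are exactly ±τ (if x = kτ, then
-- y = τ gives τ/k ∈ ℤτ, so k is a unit of ℤ).  Writing α = p(E(τ/n))/d, the
-- hypothesis σ₀(α) = α says α = p(E(-τ/n))/d as well, so the formula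
-- "∃x ∃t. x is ±τ ∧ n·t = x ∧ d·a = p(E t)" defines α whichever sign x takes.

open import Level using (Level; _⊔_; lift; lower)
open import Data.Product using (Σ; _,_; _×_)
open import Data.Empty using (⊥-elim)
open import Data.Sum using (_⊎_; inj₁; inj₂)
open import Data.Nat as ℕ using (ℕ; zero; suc)
open import Data.Nat.Properties using (m*n≡1⇒n≡1)
open import Data.Integer using (ℤ; +_; -[1+_])
open import Data.Fin using (Fin; zero; suc)
open import Data.List using (List; []; _∷_)
open import Relation.Nullary using (¬_)
open import Relation.Binary.PropositionalEquality as ≡ using (_≡_)
open import Algebra.Bundles using (CommutativeRing)
import Algebra.Properties.Ring as RingProperties
import Algebra.Properties.Semiring.Mult as SemiringMult
open import Defs

module FieldProperties {c ℓ : Level} (F : ExpField c ℓ) where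
  open ExpField F hiding (zero)
  open RingProperties (CommutativeRing.ring commRing) public
    using (+-cancelˡ; -‿distribˡ-*; -‿distribʳ-*; -‿involutive; -1*x≈-x)
  open SemiringMult semiring using (×1-homo-*) renaming (_×_ to _×ₙ_)
  open import Relation.Binary.Reasoning.Setoid setoid

  *-cancelˡ : ∀ {a x y} → ¬ (a ≈ 0#) → a * x ≈ a * y → x ≈ y
  *-cancelˡ {a} {x} {y} a≉0 ax≈ay with inverse a a≉0
  ... | b , ab≈1 = begin
    x            ≈⟨ *-identityˡ x ⟨
    1# * x       ≈⟨ *-congʳ ba≈1 ⟨
    (b * a) * x  ≈⟨ *-assoc b a x ⟩
    b * (a * x)  ≈⟨ *-congˡ ax≈ay ⟩
    b * (a * y)  ≈⟨ *-assoc b a y ⟨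
    (b * a) * y  ≈⟨ *-congʳ ba≈1 ⟩
    1# * y       ≈⟨ *-identityˡ y ⟩
    y            ∎
    where ba≈1 = trans (*-comm b a) ab≈1

  *-cancelˡ-± : ∀ {a s t u v} → ¬ (a ≈ 0#) → a * t ≈ u → a * s ≈ v →
                (v ≈ u) ⊎ (v ≈ - u) → (s ≈ t) ⊎ (s ≈ - t)
  *-cancelˡ-± a≉0 at≈u as≈v (inj₁ v≈u) =
    inj₁ (*-cancelˡ a≉0 (trans as≈v (trans v≈u (sym at≈u))))
  *-cancelˡ-± {a} {s} {t} {u} {v} a≉0 at≈u as≈v (inj₂ v≈-u) = inj₂ (*-cancelˡ a≉0 (begin
    a * s      ≈⟨ as≈v ⟩
    v          ≈⟨ v≈-u ⟩
    - u        ≈⟨ -‿cong at≈u ⟨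
    - (a * t)  ≈⟨ -‿distribʳ-* a t ⟩
    a * - t    ∎))

  natCast≡×1 : ∀ n → natCast n ≡ n ×ₙ 1#
  natCast≡×1 zero    = ≡.refl
  natCast≡×1 (suc n) = ≡.cong (_+_ 1#) (natCast≡×1 n)

  natCast-* : ∀ m n → natCast (m ℕ.* n) ≈ natCast m * natCast n
  natCast-* m n rewrite natCast≡×1 m | natCast≡×1 n | natCast≡×1 (m ℕ.* n) =
    ×1-homo-* m n

  natCast-1 : natCast 1 ≈ 1#
  natCast-1 = +-identityʳ 1#

  natCast-injective : ∀ {m n} → natCast m ≈ natCast n → m ≡ n
  natCast-injective {zero}  {zero}  _ = ≡.refl
  natCast-injective {zero}  {suc n} e = ⊥-elim (char0 n (sym e))
  natCast-injective {suc m} {zero}  e = ⊥-elim (char0 m e)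
  natCast-injective {suc m} {suc n} e =
    ≡.cong suc (natCast-injective (+-cancelˡ 1# (natCast m) (natCast n) e))

  -natCast≉1 : ∀ n → ¬ (- natCast n ≈ 1#)
  -natCast≉1 n -n≈1 = char0 n (begin
    1# + natCast n           ≈⟨ +-congʳ -n≈1 ⟨
    - natCast n + natCast n  ≈⟨ -‿inverseˡ (natCast n) ⟩
    0#                       ∎)

  natCast-unit : ∀ m n → natCast m * natCast n ≈ 1# → n ≡ 1
  natCast-unit m n mn≈1 =
    m*n≡1⇒n≡1 m n (natCast-injective (trans (natCast-* m n) (trans mn≈1 (sym natCast-1))))

  -x*-y≈x*y : ∀ x y → - x * - y ≈ x * y
  -x*-y≈x*y x y = begin
    - x * - y      ≈⟨ -‿distribʳ-* (- x) y ⟨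
    - (- x * y)    ≈⟨ -‿cong (-‿distribˡ-* x y) ⟨
    - - (x * y)    ≈⟨ -‿involutive (x * y) ⟩
    x * y          ∎

  intCast-unit : ∀ j k → intCast j * intCast k ≈ 1# → (intCast k ≈ 1#) ⊎ (intCast k ≈ - 1#)
  intCast-unit (+ m) (+ n) mn≈1 with natCast-unit m n mn≈1
  ... | ≡.refl = inj₁ natCast-1
  intCast-unit (+ m) -[1+ n ] m[-n]≈1 = ⊥-elim (-natCast≉1 (m ℕ.* suc n) (begin
    - natCast (m ℕ.* suc n)          ≈⟨ -‿cong (natCast-* m (suc n)) ⟩
    - (natCast m * natCast (suc n))  ≈⟨ -‿distribʳ-* _ _ ⟩
    natCast m * - natCast (suc n)    ≈⟨ m[-n]≈1 ⟩
    1#                               ∎))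
  intCast-unit -[1+ m ] (+ n) [-m]n≈1 = ⊥-elim (-natCast≉1 (suc m ℕ.* n) (begin
    - natCast (suc m ℕ.* n)          ≈⟨ -‿cong (natCast-* (suc m) n) ⟩
    - (natCast (suc m) * natCast n)  ≈⟨ -‿distribˡ-* _ _ ⟩
    - natCast (suc m) * natCast n    ≈⟨ [-m]n≈1 ⟩
    1#                               ∎))
  intCast-unit -[1+ m ] -[1+ n ] [-m][-n]≈1
    with natCast-unit (suc m) (suc n) (trans (sym (-x*-y≈x*y _ _)) [-m][-n]≈1)
  ... | ≡.refl = inj₂ (-‿cong natCast-1)

module KernelProperties {c ℓ : Level} (F : ExpField c ℓ) where
  open ExpField F hiding (zero)
  open FieldProperties F using (-‿distribˡ-*)
  open import Relation.Binary.Reasoning.Setoid setoid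

  InKer : Carrier → Set ℓ
  InKer x = E x ≈ 1#

  -‿InKer : ∀ {x} → InKer x → InKer (- x)
  -‿InKer {x} Ex≈1 = begin
    E (- x)          ≈⟨ *-identityʳ (E (- x)) ⟨
    E (- x) * 1#     ≈⟨ *-congˡ Ex≈1 ⟨
    E (- x) * E x    ≈⟨ E-+ (- x) x ⟨
    E (- x + x)      ≈⟨ E-cong (-‿inverseˡ x) ⟩
    E 0#             ≈⟨ E-0 ⟩
    1#               ∎

  natCast*-InKer : ∀ n {x} → InKer x → InKer (natCast n * x)
  natCast*-InKer zero    {x} _     = trans (E-cong (zeroˡ x)) E-0
  natCast*-InKer (suc n) {x} Ex≈1 = begin
    E ((1# + natCast n) * x)          ≈⟨ E-cong (distribʳ x 1# (natCast n)) ⟩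
    E (1# * x + natCast n * x)        ≈⟨ E-+ (1# * x) (natCast n * x) ⟩
    E (1# * x) * E (natCast n * x)    ≈⟨ *-cong (trans (E-cong (*-identityˡ x)) Ex≈1)
                                                (natCast*-InKer n Ex≈1) ⟩
    1# * 1#                           ≈⟨ *-identityˡ 1# ⟩
    1#                                ∎

  intCast*-InKer : ∀ k {x} → InKer x → InKer (intCast k * x)
  intCast*-InKer (+ n)         x∈Ker = natCast*-InKer n x∈Ker
  intCast*-InKer -[1+ n ] {x} x∈Ker =
    trans (E-cong (sym (-‿distribˡ-* (natCast (suc n)) x)))
          (-‿InKer (natCast*-InKer (suc n) x∈Ker))

  DividesKerSquares : Carrier → Set (c ⊔ ℓ)
  DividesKerSquares x =
    InKer x × ¬ (x ≈ 0#) × (∀ y → InKer y → ∀ z → z * x ≈ 1# → InKer ((y * y) * z))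

module KerGenerator {c ℓ : Level} (F : ExpField c ℓ)
                    (τ : ExpField.Carrier F) (τ-gen : IsKerGenerator F τ) where
  open ExpField F hiding (zero)
  open FieldProperties F using (*-cancelˡ; intCast-unit; -1*x≈-x)
  open KernelProperties F
  open import Relation.Binary.Reasoning.Setoid setoid

  private
    τ∈Ker : InKer τ
    τ∈Ker = Σ.proj₁ τ-gen

    τ≉0 : ¬ (τ ≈ 0#)
    τ≉0 = Σ.proj₁ (Σ.proj₂ τ-gen)

    Ker⊆ℤτ : ∀ x → InKer x → Σ ℤ λ k → x ≈ intCast k * τ
    Ker⊆ℤτ = Σ.proj₂ (Σ.proj₂ τ-gen)

  generator-dividesKerSquares : DividesKerSquares τ
  generator-dividesKerSquares = τ∈Ker , τ≉0 , yyz∈Ker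
    where
    yyz∈Ker : ∀ y → InKer y → ∀ z → z * τ ≈ 1# → InKer ((y * y) * z)
    yyz∈Ker y y∈Ker z zτ≈1 with Ker⊆ℤτ y y∈Ker
    ... | k , y≈kτ = trans (E-cong yyz≈ky) (intCast*-InKer k y∈Ker)
      where
      yyz≈ky : (y * y) * z ≈ intCast k * y
      yyz≈ky = begin
        (y * y) * z                ≈⟨ *-assoc y y z ⟩
        y * (y * z)                ≈⟨ *-congˡ (*-congʳ y≈kτ) ⟩
        y * ((intCast k * τ) * z)  ≈⟨ *-congˡ (*-assoc (intCast k) τ z) ⟩
        y * (intCast k * (τ * z))  ≈⟨ *-congˡ (*-congˡ (trans (*-comm τ z) zτ≈1)) ⟩
        y * (intCast k * 1#)       ≈⟨ *-congˡ (*-identityʳ (intCast k)) ⟩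
        y * intCast k              ≈⟨ *-comm y (intCast k) ⟩
        intCast k * y              ∎

  dividesKerSquares⇒±generator : ∀ {x} → DividesKerSquares x → (x ≈ τ) ⊎ (x ≈ - τ)
  dividesKerSquares⇒±generator {x} (x∈Ker , x≉0 , squares) with inverse x x≉0 | Ker⊆ℤτ x x∈Ker
  ... | z , xz≈1 | k , x≈kτ with Ker⊆ℤτ _ (squares τ τ∈Ker z (trans (*-comm z x) xz≈1))
  ... | j , ττz≈jτ = sign (intCast-unit j k jk≈1)
    where
    τz≈j : τ * z ≈ intCast j
    τz≈j = *-cancelˡ τ≉0 (begin
      τ * (τ * z)    ≈⟨ *-assoc τ τ z ⟨
      (τ * τ) * z    ≈⟨ ττz≈jτ ⟩
      intCast j * τ  ≈⟨ *-comm (intCast j) τ ⟩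
      τ * intCast j  ∎)
    jk≈1 : intCast j * intCast k ≈ 1#
    jk≈1 = *-cancelˡ τ≉0 (begin
      τ * (intCast j * intCast k)    ≈⟨ *-congˡ (*-congʳ τz≈j) ⟨
      τ * ((τ * z) * intCast k)      ≈⟨ *-comm τ _ ⟩
      ((τ * z) * intCast k) * τ      ≈⟨ *-assoc (τ * z) (intCast k) τ ⟩
      (τ * z) * (intCast k * τ)      ≈⟨ *-congˡ x≈kτ ⟨
      (τ * z) * x                    ≈⟨ *-assoc τ z x ⟩
      τ * (z * x)                    ≈⟨ *-congˡ (trans (*-comm z x) xz≈1) ⟩
      τ * 1#                         ∎)
    sign : (intCast k ≈ 1#) ⊎ (intCast k ≈ - 1#) → (x ≈ τ) ⊎ (x ≈ - τ)
    sign (inj₁ k≈1)  = inj₁ (trans x≈kτ (trans (*-congʳ k≈1) (*-identityˡ τ)))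
    sign (inj₂ k≈-1) = inj₂ (trans x≈kτ (trans (*-congʳ k≈-1) (-1*x≈-x τ)))

numeral : ∀ {m} → ℕ → Term m
numeral zero    = zer
numeral (suc n) = one ⊕ numeral n

integer : ∀ {m} → ℤ → Term m
integer (+ n)    = numeral n
integer -[1+ n ] = neg (numeral (suc n))

polynomial : ∀ {m} → List ℤ → Term m → Term m
polynomial []       x = zer
polynomial (a ∷ as) x = integer a ⊕ (x ⊗ polynomial as x)

-- x := var zero; in the scope of ∀y ∀z, the variables z, y, x are var 0, 1, 2.
dividesKerSquaresᶠ : ∀ {m} → Formula (suc m)
dividesKerSquaresᶠ =
  (exp x ≐ one) ∧ ((~ (x ≐ zer)) ∧
    all ((exp (var zero) ≐ one) ⇒
      all (((var zero ⊗ var (suc (suc zero))) ≐ one) ⇒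
           (exp ((var (suc zero) ⊗ var (suc zero)) ⊗ var zero) ≐ one))))
  where x = var zero

-- ∃x. x = ±τ ∧ ∃t. (n+1)·t = x ∧ (d+1)·a = p(E t); inside, t, x, a are var 0, 1, 2.
definingFormula : ℕ → ℕ → List ℤ → Formula 1
definingFormula n d p =
  ex (dividesKerSquaresᶠ ∧
      ex (((numeral (suc n) ⊗ var zero) ≐ var (suc zero)) ∧
          ((numeral (suc d) ⊗ var (suc (suc zero))) ≐ polynomial p (exp (var zero)))))

module Semantics {c ℓ : Level} (F : ExpField c ℓ) where
  open ExpField F hiding (zero)
  open KernelProperties F using (DividesKerSquares)

  ⟦numeral⟧ : ∀ {m} n (ρ : Fin m → Carrier) → ⟦ F ⟧t (numeral n) ρ ≡ natCast n
  ⟦numeral⟧ zero    ρ = ≡.refl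
  ⟦numeral⟧ (suc n) ρ = ≡.cong (_+_ 1#) (⟦numeral⟧ n ρ)

  ⟦integer⟧ : ∀ {m} k (ρ : Fin m → Carrier) → ⟦ F ⟧t (integer k) ρ ≡ intCast k
  ⟦integer⟧ (+ n)    ρ = ⟦numeral⟧ n ρ
  ⟦integer⟧ -[1+ n ] ρ = ≡.cong -_ (⟦numeral⟧ (suc n) ρ)

  ⟦polynomial⟧ : ∀ {m} p x (ρ : Fin m → Carrier) →
                 ⟦ F ⟧t (polynomial p x) ρ ≡ evalPoly F p (⟦ F ⟧t x ρ)
  ⟦polynomial⟧ []      x ρ = ≡.refl
  ⟦polynomial⟧ (a ∷ p) x ρ =
    ≡.cong₂ (λ u v → u + ⟦ F ⟧t x ρ * v) (⟦integer⟧ a ρ) (⟦polynomial⟧ p x ρ)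

  evalPoly-cong : ∀ p {x y} → x ≈ y → evalPoly F p x ≈ evalPoly F p y
  evalPoly-cong []      x≈y = refl
  evalPoly-cong (a ∷ p) x≈y = +-congˡ (*-cong x≈y (evalPoly-cong p x≈y))

  sat-dividesKerSquaresᶠ : ∀ {m} (ρ : Fin (suc m) → Carrier) →
                           DividesKerSquares (ρ zero) → Sat F dividesKerSquaresᶠ ρ
  sat-dividesKerSquaresᶠ ρ (x∈Ker , x≉0 , squares) =
    lift x∈Ker , (λ x≈0 → x≉0 (lower x≈0)) ,
    λ y y∈Ker z zx≈1 → lift (squares y (lower y∈Ker) z (lower zx≈1))

  sat-dividesKerSquaresᶠ⁻ : ∀ {m} (ρ : Fin (suc m) → Carrier) →
                            Sat F dividesKerSquaresᶠ ρ → DividesKerSquares (ρ zero)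
  sat-dividesKerSquaresᶠ⁻ ρ (x∈Ker , x≉0 , squares) =
    lower x∈Ker , (λ x≈0 → x≉0 (lift x≈0)) ,
    λ y y∈Ker z zx≈1 → lower (squares y (lift y∈Ker) z (lift zx≈1))

  module _ (n d : ℕ) (p : List ℤ) where

    definingFormula-sound : ∀ {x t a} → DividesKerSquares x → natCast (suc n) * t ≈ x →
                            natCast (suc d) * a ≈ evalPoly F p (E t) →
                            Sat F (definingFormula n d p) (λ _ → a)
    definingFormula-sound {x} {t} {a} x-div nt≈x da≈p[Et] =
      x , sat-dividesKerSquaresᶠ (extend F x λ (_ : Fin 1) → a) x-div , t ,
      lift (trans (*-congʳ (reflexive (⟦numeral⟧ (suc n) _))) nt≈x) ,
      lift (trans (*-congʳ (reflexive (⟦numeral⟧ (suc d) _)))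
                  (trans da≈p[Et] (reflexive (≡.sym (⟦polynomial⟧ p (exp (var zero)) _)))))

    definingFormula-complete : ∀ {a} → Sat F (definingFormula n d p) (λ _ → a) →
                               Σ Carrier λ x → Σ Carrier λ t →
                               DividesKerSquares x × natCast (suc n) * t ≈ x ×
                               natCast (suc d) * a ≈ evalPoly F p (E t)
    definingFormula-complete {a} (x , x-div , t , nt≈x , da≈p[Et]) =
      x , t , sat-dividesKerSquaresᶠ⁻ (extend F x λ (_ : Fin 1) → a) x-div ,
      trans (*-congʳ (reflexive (≡.sym (⟦numeral⟧ (suc n) _)))) (lower nt≈x) ,
      trans (*-congʳ (reflexive (≡.sym (⟦numeral⟧ (suc d) _))))
            (trans (lower da≈p[Et]) (reflexive (⟦polynomial⟧ p (exp (var zero)) _)))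

theorem1 : {c ℓ : Level} (F : ExpField c ℓ) →
           (K : KerInfiniteCyclic F) →
           ∀ α → IsRealAbelian F (Σ.proj₁ K) α → PointwiseDefinable F α
theorem1 F (τ , τ-gen) α (n , t , p , d , nt≈τ , dα≈p[Et] , dα≈p[E-t]) =
  definingFormula n d p ,
  definingFormula-sound n d p generator-dividesKerSquares nt≈τ dα≈p[Et] ,
  satisfiers≈α
  where
  open ExpField F hiding (zero)
  open FieldProperties F using (*-cancelˡ; *-cancelˡ-±)
  open KerGenerator F τ τ-gen
  open Semantics F

  p[Es]≈dα : ∀ {s} → (s ≈ t) ⊎ (s ≈ - t) → evalPoly F p (E s) ≈ natCast (suc d) * α
  p[Es]≈dα (inj₁ s≈t)  = trans (evalPoly-cong p (E-cong s≈t)) (sym dα≈p[Et])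
  p[Es]≈dα (inj₂ s≈-t) = trans (evalPoly-cong p (E-cong s≈-t)) (sym dα≈p[E-t])

  satisfiers≈α : ∀ y → Sat F (definingFormula n d p) (λ _ → y) → y ≈ α
  satisfiers≈α y sat with definingFormula-complete n d p sat
  ... | x , s , x-div , ns≈x , dy≈p[Es] =
    *-cancelˡ (char0 d) (trans dy≈p[Es] (p[Es]≈dα
      (*-cancelˡ-± (char0 n) nt≈τ ns≈x (dividesKerSquares⇒±generator x-div))))
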